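{- There exist absolute constants $c>0$ and $n_0$ such that the following holds for all $n\ge n_0$ and all $\epsilon\in(0,1/2]$ with $\epsilon n$ a positive integer. Let $r=n-\epsilon n$, $s=\epsilon n$, and consider $n$ points $x_1,\dots,x_r,y_1,\dots,y_s$ with the symmetric distance matrix $M$ given by $M(p,p)=0$ for every point $p$, $M(x_i,x_j)=2n$ for $i\ne j$, $M(x_i,y_j)=2n+i$, and $M(y_i,y_j)=2n$ for $i\ne j$. Then $M$ differs in at least $c\epsilon n^2$ entries from every ultrametric on these $n$ points, and in at least $c\epsilon n^2$ entries from every tree metric on these $n$ points.
   Context: A matrix is an ultrametric if it is a metric ($M(p,q)\ge0$ with equality iff $p=q$, symmetric, triangle inequality) and $M(p,q)\le\max\{M(p,t),M(q,t)\}$ for all points $p,q,t$. It is a tree metric if it is a metric and its points can be mapped injectively to the leaves of a finite tree with nonnegative edge weights so that $M(p,q)$ is the weighted length of the path between the images of $p$ and $q$.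
   Formalization: The ultrametrics and tree metrics that M must differ from take only rational values rather than real ones, and the trees realising the tree metrics have rational edge weights. -}

module Defs where

open import Data.Nat as ℕ using (ℕ; suc)
open import Data.Integer using (+_)
open import Data.Rational using (ℚ; 0ℚ; _≤_; _+_; _⊔_; _/_)
open import Data.Rational.Properties using (_≟_)
open import Data.Fin using (Fin; toℕ)
open import Data.Fin.Properties using () renaming (_≟_ to _≟ᶠ_)
open import Data.Sum using (_⊎_; inj₁; inj₂)
open import Data.Product using (_×_; _,_; proj₁; proj₂; Σ; ∃)
open import Data.List using (List; length; lookup; map; _++_; filter; cartesianProduct; allFin)
open import Data.List.Relation.Unary.All using (All)
open import Relation.Nullary using (¬_; yes; no; ¬?)
open import Relation.Binary.PropositionalEquality using (_≡_; refl)
open import Function.Bundles using (_⇔_)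
open import Function.Definitions using (Injective)

⟦_⟧ : ℕ → ℚ
⟦ n ⟧ = (+ n) / 1

Matrix : Set → Set
Matrix P = P → P → ℚ

record IsMetric {P : Set} (M : Matrix P) : Set where
  field
    nonneg   : ∀ p q → 0ℚ ≤ M p q
    zero-iff : ∀ p q → (M p q ≡ 0ℚ) ⇔ (p ≡ q)
    symm     : ∀ p q → M p q ≡ M q p
    triangle : ∀ p q t → M p q ≤ M p t + M t q

record IsUltrametric {P : Set} (M : Matrix P) : Set where
  field
    metric : IsMetric M
    ultra  : ∀ p q t → M p q ≤ (M p t ⊔ M q t)

-- Finite trees with edge weights (rose trees; every edge to a child
-- carries a weight).  Any finite tree, rooted at an arbitrary vertex,
-- is of this form.

data WTree : Set where
  node : List (ℚ × WTree) → WTree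

children : WTree → List (ℚ × WTree)
children (node cs) = cs

data NonNegWeights : WTree → Set where
  node : ∀ {cs} → All (λ c → (0ℚ ≤ proj₁ c) × NonNegWeights (proj₂ c)) cs →
         NonNegWeights (node cs)

data Vtx : WTree → Set where
  here  : ∀ {t} → Vtx t
  there : ∀ {cs} (i : Fin (length cs)) → Vtx (proj₂ (lookup cs i)) → Vtx (node cs)

subAt : (t : WTree) → Vtx t → WTree
subAt t here = t
subAt (node cs) (there i v) = subAt (proj₂ (lookup cs i)) v

-- a leaf is a vertex of degree one
IsLeaf : (t : WTree) → Vtx t → Set
IsLeaf t here = length (children t) ≡ 1
IsLeaf (node cs) (there i v) = length (children (subAt (proj₂ (lookup cs i)) v)) ≡ 0

depth : (t : WTree) → Vtx t → ℚ
depth t here = 0ℚ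
depth (node cs) (there i v) = proj₁ (lookup cs i) + depth (proj₂ (lookup cs i)) v

pathLen : (t : WTree) → Vtx t → Vtx t → ℚ
pathLen t here v = depth t v
pathLen t (there i u) here = depth t (there i u)
pathLen (node cs) (there i u) (there j v) with i ≟ᶠ j
... | yes refl = pathLen (proj₂ (lookup cs i)) u v
... | no _ = depth (node cs) (there i u) + depth (node cs) (there j v)

record IsTreeMetric {P : Set} (M : Matrix P) : Set where
  field
    metric   : IsMetric M
    tree     : WTree
    weights  : NonNegWeights tree
    embed    : P → Vtx tree
    injective : Injective _≡_ _≡_ embed
    leaves   : ∀ p → IsLeaf tree (embed p)
    realises : ∀ p q → M p q ≡ pathLen tree (embed p) (embed q)

-- The point set x_1..x_r, y_1..y_s  (x_{k+1} = inj₁ k, y_{k+1} = inj₂ k)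

Pt : ℕ → ℕ → Set
Pt r s = Fin r ⊎ Fin s

points : (r s : ℕ) → List (Pt r s)
points r s = map inj₁ (allFin r) ++ map inj₂ (allFin s)

hardM : (r s : ℕ) → Matrix (Pt r s)
hardM r s (inj₁ i) (inj₁ j) with i ≟ᶠ j
... | yes _ = 0ℚ
... | no _ = ⟦ 2 ℕ.* (r ℕ.+ s) ⟧
hardM r s (inj₁ i) (inj₂ j) = ⟦ 2 ℕ.* (r ℕ.+ s) ℕ.+ suc (toℕ i) ⟧
hardM r s (inj₂ j) (inj₁ i) = ⟦ 2 ℕ.* (r ℕ.+ s) ℕ.+ suc (toℕ i) ⟧
hardM r s (inj₂ i) (inj₂ j) with i ≟ᶠ j
... | yes _ = 0ℚ
... | no _ = ⟦ 2 ℕ.* (r ℕ.+ s) ⟧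

-- number of entries (ordered pairs (p,q)) in which two matrices differ
diffCount : (r s : ℕ) → Matrix (Pt r s) → Matrix (Pt r s) → ℕ
diffCount r s A B =
  length (filter (λ pq → ¬? (A (proj₁ pq) (proj₂ pq) ≟ B (proj₁ pq) (proj₂ pq)))
                 (cartesianProduct (points r s) (points r s)))

{-# OPTIONS --safe #-}

-- A tree metric is d(u, v) = D u + D v - 2 (u | v), where D is the depth below a root and
-- (u | v) the depth of the meet of u and v. Of the three meets of three points two coincide,
-- so of the three pairings of four points two have equal sums. For a < b < c, M violates
-- the ultrametric inequality on x_a, x_b, y_j, since 2n + b > max (2n, 2n + a), and its
-- pairing sums on x_a, x_b, x_c, y_j are 4n + c, 4n + b, 4n + a, all distinct. So an
-- ultrametric or tree metric differs from M on one of the six pairs of every such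
-- quadruple. For q = r / 6, the q * min (s, q) quadruples with x-indices a, q + a + j and
-- 3q + a + 2j (a < q, j < min (s, q)) share no pair, as each pair determines (a, j); and
-- q * min (s, q) ≥ s n / 288.
module Submission where

open import Defs
open import Data.Nat as ℕ using (ℕ)

module FourPointCondition where

  open import Data.Rational using (ℚ; 0ℚ; _+_; _-_)
  open import Data.Rational.Properties using (+-identityˡ; +-identityʳ)
  open import Data.Rational.Solver using (module +-*-Solver)
  open import Data.Fin using (Fin)
  open import Data.Fin.Properties using () renaming (_≟_ to _≟ᶠ_)
  open import Data.Product using (_×_; proj₁; proj₂)
  open import Function using (_∘_)
  open import Data.Sum using (_⊎_; inj₁; inj₂)
  open import Data.List using (List; length; lookup)
  open import Data.Empty using (⊥-elim)
  open import Relation.Nullary using (Dec; yes; no)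
  open import Relation.Binary.PropositionalEquality
  open +-*-Solver

  TwoEqual : {A : Set} → A → A → A → Set
  TwoEqual a b c = a ≡ b ⊎ a ≡ c ⊎ b ≡ c

  module _ {A : Set} {a b c : A} where

    TwoEqual-map : {B : Set} (f : A → B) → TwoEqual a b c → TwoEqual (f a) (f b) (f c)
    TwoEqual-map f (inj₁ a≡b)        = inj₁ (cong f a≡b)
    TwoEqual-map f (inj₂ (inj₁ a≡c)) = inj₂ (inj₁ (cong f a≡c))
    TwoEqual-map f (inj₂ (inj₂ b≡c)) = inj₂ (inj₂ (cong f b≡c))

    TwoEqual-resp : {a′ b′ c′ : A} → a ≡ a′ → b ≡ b′ → c ≡ c′ → TwoEqual a b c → TwoEqual a′ b′ c′
    TwoEqual-resp refl refl refl t = t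

    TwoEqual-swap₁₂ : TwoEqual a b c → TwoEqual b a c
    TwoEqual-swap₁₂ (inj₁ a≡b)        = inj₁ (sym a≡b)
    TwoEqual-swap₁₂ (inj₂ (inj₁ a≡c)) = inj₂ (inj₂ a≡c)
    TwoEqual-swap₁₂ (inj₂ (inj₂ b≡c)) = inj₂ (inj₁ b≡c)

    TwoEqual-swap₂₃ : TwoEqual a b c → TwoEqual a c b
    TwoEqual-swap₂₃ (inj₁ a≡b)        = inj₂ (inj₁ a≡b)
    TwoEqual-swap₂₃ (inj₂ (inj₁ a≡c)) = inj₁ a≡c
    TwoEqual-swap₂₃ (inj₂ (inj₂ b≡c)) = inj₂ (inj₂ (sym b≡c))

  -- Weaker than the usual four-point condition, which asks that the two largest sums coincide.
  FourPoint : {P : Set} → (P → P → ℚ) → P → P → P → P → Set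
  FourPoint d u v w z = TwoEqual (d u v + d w z) (d u w + d v z) (d u z + d v w)

  private
    absorbˡ : ∀ {x} y → x ≡ 0ℚ → y ≡ x + y
    absorbˡ y refl = sym (+-identityˡ y)

    absorbʳ : ∀ {x} y → x ≡ 0ℚ → y ≡ y + x
    absorbʳ y refl = sym (+-identityʳ y)

  module _ {P : Set} (d : P → P → ℚ) (u v w z : P) where

    fourPoint-orthogonal₁ : d u v ≡ 0ℚ → d u w ≡ 0ℚ → d u z ≡ 0ℚ →
                            TwoEqual (d v w) (d v z) (d w z) → FourPoint d u v w z
    fourPoint-orthogonal₁ uv uw uz t =
      TwoEqual-resp (absorbˡ _ uv) (absorbˡ _ uw) (absorbˡ _ uz)
        (TwoEqual-swap₁₂ (TwoEqual-swap₂₃ (TwoEqual-swap₁₂ t)))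

    fourPoint-orthogonal₂ : d u v ≡ 0ℚ → d v w ≡ 0ℚ → d v z ≡ 0ℚ →
                            TwoEqual (d u w) (d u z) (d w z) → FourPoint d u v w z
    fourPoint-orthogonal₂ uv vw vz t =
      TwoEqual-resp (absorbˡ _ uv) (absorbʳ _ vz) (absorbʳ _ vw)
        (TwoEqual-swap₁₂ (TwoEqual-swap₂₃ t))

    fourPoint-orthogonal₃ : d u w ≡ 0ℚ → d v w ≡ 0ℚ → d w z ≡ 0ℚ →
                            TwoEqual (d u v) (d u z) (d v z) → FourPoint d u v w z
    fourPoint-orthogonal₃ uw vw wz t =
      TwoEqual-resp (absorbʳ _ wz) (absorbˡ _ uw) (absorbʳ _ vw) (TwoEqual-swap₂₃ t)

    fourPoint-orthogonal₄ : d u z ≡ 0ℚ → d v z ≡ 0ℚ → d w z ≡ 0ℚ →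
                            TwoEqual (d u v) (d u w) (d v w) → FourPoint d u v w z
    fourPoint-orthogonal₄ uz vz wz t =
      TwoEqual-resp (absorbʳ _ wz) (absorbʳ _ vz) (absorbˡ _ uz) t

  weight : (cs : List (ℚ × WTree)) → Fin (length cs) → ℚ
  weight cs i = proj₁ (lookup cs i)

  child : (cs : List (ℚ × WTree)) → Fin (length cs) → WTree
  child cs i = proj₂ (lookup cs i)

  meetDepth : (t : WTree) → Vtx t → Vtx t → ℚ
  meetDepth t here        v    = 0ℚ
  meetDepth t (there _ _) here = 0ℚ
  meetDepth (node cs) (there i u) (there j v) with i ≟ᶠ j
  ... | yes refl = weight cs i + meetDepth (child cs i) u v
  ... | no _     = 0ℚ

  module _ (cs : List (ℚ × WTree)) where

    meetDepth-same : ∀ i u v → meetDepth (node cs) (there i u) (there i v) ≡ weight cs i + meetDepth (child cs i) u v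
    meetDepth-same i u v with i ≟ᶠ i
    ... | yes refl = refl
    ... | no i≢i   = ⊥-elim (i≢i refl)

    meetDepth-apart : ∀ {i j} u v → i ≢ j → meetDepth (node cs) (there i u) (there j v) ≡ 0ℚ
    meetDepth-apart {i} {j} u v i≢j with i ≟ᶠ j
    ... | yes i≡j = ⊥-elim (i≢j i≡j)
    ... | no _    = refl

  meetDepth-threePoint : ∀ t (u v w : Vtx t) → TwoEqual (meetDepth t u v) (meetDepth t u w) (meetDepth t v w)
  meetDepth-threePoint t here v w = inj₁ refl
  meetDepth-threePoint t (there _ _) here w = inj₂ (inj₁ refl)
  meetDepth-threePoint t (there _ _) (there _ _) here = inj₂ (inj₂ refl)
  meetDepth-threePoint (node cs) (there i u) (there j v) (there k w) with i ≟ᶠ j | i ≟ᶠ k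
  ... | yes refl | yes refl =
    TwoEqual-resp refl refl (sym (meetDepth-same cs i v w))
      (TwoEqual-map (weight cs i +_) (meetDepth-threePoint (child cs i) u v w))
  ... | yes refl | no i≢k   = inj₂ (inj₂ (sym (meetDepth-apart cs v w i≢k)))
  ... | no i≢j   | yes refl = inj₂ (inj₁ (sym (meetDepth-apart cs v w (i≢j ∘ sym))))
  ... | no _     | no _     = inj₁ refl

  meetDepth-fourPoint : ∀ t (u v w z : Vtx t) → FourPoint (meetDepth t) u v w z

  meetDepth-fourPoint-node : ∀ cs {i j k l} u v w z → Dec (i ≡ j) → Dec (i ≡ k) → Dec (i ≡ l) →
    FourPoint (meetDepth (node cs)) (there i u) (there j v) (there k w) (there l z)
  meetDepth-fourPoint-node cs {i} u v w z (yes refl) (yes refl) (yes refl) =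
    TwoEqual-resp (lift u v w z) (lift u w v z) (lift u z v w)
      (TwoEqual-map (W + W +_) (meetDepth-fourPoint (child cs i) u v w z))
    where
    W : ℚ
    W = weight cs i
    H : Vtx (child cs i) → Vtx (child cs i) → ℚ
    H = meetDepth (child cs i)
    lift : ∀ p q p′ q′ → (W + W) + (H p q + H p′ q′) ≡
           meetDepth (node cs) (there i p) (there i q) + meetDepth (node cs) (there i p′) (there i q′)
    lift p q p′ q′ = trans (solve 3 (λ w a b → (w :+ w) :+ (a :+ b) := (w :+ a) :+ (w :+ b)) refl W (H p q) (H p′ q′))
                           (sym (cong₂ _+_ (meetDepth-same cs i p q) (meetDepth-same cs i p′ q′)))
  meetDepth-fourPoint-node cs {i} {l = l} u v w z (yes refl) (yes refl) (no i≢l) =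
    fourPoint-orthogonal₄ (meetDepth (node cs)) (there i u) (there i v) (there i w) (there l z)
      (meetDepth-apart cs u z i≢l) (meetDepth-apart cs v z i≢l) (meetDepth-apart cs w z i≢l)
      (meetDepth-threePoint (node cs) (there i u) (there i v) (there i w))
  meetDepth-fourPoint-node cs {i} {k = k} u v w z (yes refl) (no i≢k) (yes refl) =
    fourPoint-orthogonal₃ (meetDepth (node cs)) (there i u) (there i v) (there k w) (there i z)
      (meetDepth-apart cs u w i≢k) (meetDepth-apart cs v w i≢k) (meetDepth-apart cs w z (i≢k ∘ sym))
      (meetDepth-threePoint (node cs) (there i u) (there i v) (there i z))
  meetDepth-fourPoint-node cs u v w z (yes refl) (no i≢k) (no i≢l) =
    inj₂ (inj₂ (cong₂ _+_ (trans (meetDepth-apart cs u w i≢k) (sym (meetDepth-apart cs u z i≢l)))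
                          (trans (meetDepth-apart cs v z i≢l) (sym (meetDepth-apart cs v w i≢k)))))
  meetDepth-fourPoint-node cs {i} {j} u v w z (no i≢j) (yes refl) (yes refl) =
    fourPoint-orthogonal₂ (meetDepth (node cs)) (there i u) (there j v) (there i w) (there i z)
      (meetDepth-apart cs u v i≢j) (meetDepth-apart cs v w (i≢j ∘ sym)) (meetDepth-apart cs v z (i≢j ∘ sym))
      (meetDepth-threePoint (node cs) (there i u) (there i w) (there i z))
  meetDepth-fourPoint-node cs u v w z (no i≢j) (yes refl) (no i≢l) =
    inj₂ (inj₁ (cong₂ _+_ (trans (meetDepth-apart cs u v i≢j) (sym (meetDepth-apart cs u z i≢l)))
                          (trans (meetDepth-apart cs w z i≢l) (sym (meetDepth-apart cs v w (i≢j ∘ sym))))))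
  meetDepth-fourPoint-node cs u v w z (no i≢j) (no i≢k) (yes refl) =
    inj₁ (cong₂ _+_ (trans (meetDepth-apart cs u v i≢j) (sym (meetDepth-apart cs u w i≢k)))
                    (trans (meetDepth-apart cs w z (i≢k ∘ sym)) (sym (meetDepth-apart cs v z (i≢j ∘ sym)))))
  meetDepth-fourPoint-node cs {i} {j} {k} {l} u v w z (no i≢j) (no i≢k) (no i≢l) =
    fourPoint-orthogonal₁ (meetDepth (node cs)) (there i u) (there j v) (there k w) (there l z)
      (meetDepth-apart cs u v i≢j) (meetDepth-apart cs u w i≢k) (meetDepth-apart cs u z i≢l)
      (meetDepth-threePoint (node cs) (there j v) (there k w) (there l z))

  meetDepth-fourPoint t here v w z =
    fourPoint-orthogonal₁ (meetDepth t) here v w z refl refl refl (meetDepth-threePoint t v w z)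
  meetDepth-fourPoint t u@(there _ _) here w z =
    fourPoint-orthogonal₂ (meetDepth t) u here w z refl refl refl (meetDepth-threePoint t u w z)
  meetDepth-fourPoint t u@(there _ _) v@(there _ _) here z =
    fourPoint-orthogonal₃ (meetDepth t) u v here z refl refl refl (meetDepth-threePoint t u v z)
  meetDepth-fourPoint t u@(there _ _) v@(there _ _) w@(there _ _) here =
    fourPoint-orthogonal₄ (meetDepth t) u v w here refl refl refl (meetDepth-threePoint t u v w)
  meetDepth-fourPoint (node cs) (there i u) (there j v) (there k w) (there l z) =
    meetDepth-fourPoint-node cs u v w z (i ≟ᶠ j) (i ≟ᶠ k) (i ≟ᶠ l)

  pathLen-viaMeet : ∀ t (u v : Vtx t) →
    pathLen t u v ≡ (depth t u + depth t v) - (meetDepth t u v + meetDepth t u v)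
  pathLen-viaMeet t here v =
    solve 1 (λ x → x := (con 0ℚ :+ x) :- (con 0ℚ :+ con 0ℚ)) refl (depth t v)
  pathLen-viaMeet t u@(there _ _) here =
    solve 1 (λ x → x := (x :+ con 0ℚ) :- (con 0ℚ :+ con 0ℚ)) refl (depth t u)
  pathLen-viaMeet (node cs) (there i u) (there j v) with i ≟ᶠ j
  ... | yes refl =
    trans (pathLen-viaMeet (child cs i) u v)
          (solve 4 (λ w a b h → (a :+ b) :- (h :+ h) := ((w :+ a) :+ (w :+ b)) :- ((w :+ h) :+ (w :+ h))) refl
                 (weight cs i) (depth (child cs i) u) (depth (child cs i) v) (meetDepth (child cs i) u v))
  ... | no _ =
    solve 2 (λ a b → a :+ b := (a :+ b) :- (con 0ℚ :+ con 0ℚ)) refl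
          (depth (node cs) (there i u)) (depth (node cs) (there j v))

  pathLen-fourPoint : ∀ t (u v w z : Vtx t) → FourPoint (pathLen t) u v w z
  pathLen-fourPoint t u v w z =
    TwoEqual-resp (pairing u v w z refl) (pairing u w v z total₂) (pairing u z v w total₃)
      (TwoEqual-map (λ x → T - (x + x)) (meetDepth-fourPoint t u v w z))
    where
    D : Vtx t → ℚ
    D = depth t
    H : Vtx t → Vtx t → ℚ
    H = meetDepth t
    T : ℚ
    T = (D u + D v) + (D w + D z)
    total₂ : (D u + D w) + (D v + D z) ≡ T
    total₂ = solve 4 (λ a b c e → (a :+ c) :+ (b :+ e) := (a :+ b) :+ (c :+ e)) refl (D u) (D v) (D w) (D z)
    total₃ : (D u + D z) + (D v + D w) ≡ T
    total₃ = solve 4 (λ a b c e → (a :+ e) :+ (b :+ c) := (a :+ b) :+ (c :+ e)) refl (D u) (D v) (D w) (D z)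
    pairing : ∀ p q p′ q′ → (D p + D q) + (D p′ + D q′) ≡ T →
              T - ((H p q + H p′ q′) + (H p q + H p′ q′)) ≡ pathLen t p q + pathLen t p′ q′
    pairing p q p′ q′ total = begin
      T - ((H p q + H p′ q′) + (H p q + H p′ q′))
        ≡⟨ cong (_- ((H p q + H p′ q′) + (H p q + H p′ q′))) total ⟨
      ((D p + D q) + (D p′ + D q′)) - ((H p q + H p′ q′) + (H p q + H p′ q′))
        ≡⟨ solve 6 (λ a b c e x y → ((a :+ b) :+ (c :+ e)) :- ((x :+ y) :+ (x :+ y))
                                    := ((a :+ b) :- (x :+ x)) :+ ((c :+ e) :- (y :+ y)))
                 refl (D p) (D q) (D p′) (D q′) (H p q) (H p′ q′) ⟩
      ((D p + D q) - (H p q + H p q)) + ((D p′ + D q′) - (H p′ q′ + H p′ q′))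
        ≡⟨ cong₂ _+_ (pathLen-viaMeet t p q) (pathLen-viaMeet t p′ q′) ⟨
      pathLen t p q + pathLen t p′ q′ ∎
      where open ≡-Reasoning

  treeMetric-fourPoint : ∀ {P} {U : Matrix P} → IsTreeMetric U → ∀ p q p′ q′ → FourPoint U p q p′ q′
  treeMetric-fourPoint {U = U} T p q p′ q′ =
    TwoEqual-resp (realised p q p′ q′) (realised p p′ q q′) (realised p q′ q p′)
      (pathLen-fourPoint tree (embed p) (embed q) (embed p′) (embed q′))
    where
    open IsTreeMetric T
    realised : ∀ a b c e → pathLen tree (embed a) (embed b) + pathLen tree (embed c) (embed e) ≡ U a b + U c e
    realised a b c e = sym (cong₂ _+_ (realises a b) (realises c e))

module NaturalEmbedding where

  import Data.Nat as ℕ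
  import Data.Nat.Properties as ℕ
  open import Data.Nat.Coprimality using (1-coprimeTo)
  import Data.Nat.Coprimality as Coprime
  open import Data.Integer as ℤ using (+_; +≤+; +<+)
  open import Data.Integer.Properties using (+-injective; drop‿+≤+; *-identityˡ; *-identityʳ; pos-*)
  open import Data.Rational using (ℚ; mkℚ; _≤_; *≤*; _<_; *<*; _*_; _/_; 0ℚ; toℚᵘ)
  open import Data.Rational.Properties using (normalize-coprime; drop-*≤*; toℚᵘ-cancel-≤; toℚᵘ-homo-*)
  import Data.Rational.Unnormalised as ℚᵘ
  import Data.Rational.Unnormalised.Properties as ℚᵘ
  open import Relation.Binary.PropositionalEquality

  ⟦⟧≡mkℚ : ∀ n → ⟦ n ⟧ ≡ mkℚ (+ n) 0 (Coprime.sym (1-coprimeTo n))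
  ⟦⟧≡mkℚ n = normalize-coprime (Coprime.sym (1-coprimeTo n))

  ⟦⟧-injective : ∀ {m n} → ⟦ m ⟧ ≡ ⟦ n ⟧ → m ≡ n
  ⟦⟧-injective {m} {n} eq = +-injective (cong ℚ.numerator (trans (sym (⟦⟧≡mkℚ m)) (trans eq (⟦⟧≡mkℚ n))))

  ⟦⟧-mono-≤ : ∀ {m n} → m ℕ.≤ n → ⟦ m ⟧ ≤ ⟦ n ⟧
  ⟦⟧-mono-≤ {m} {n} m≤n = subst₂ _≤_ (sym (⟦⟧≡mkℚ m)) (sym (⟦⟧≡mkℚ n))
    (*≤* (subst₂ ℤ._≤_ (sym (*-identityʳ (+ m))) (sym (*-identityʳ (+ n))) (+≤+ m≤n)))

  ⟦⟧-cancel-≤ : ∀ {m n} → ⟦ m ⟧ ≤ ⟦ n ⟧ → m ℕ.≤ n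
  ⟦⟧-cancel-≤ {m} {n} le = drop‿+≤+ (subst₂ ℤ._≤_ (*-identityʳ (+ m)) (*-identityʳ (+ n))
    (drop-*≤* (subst₂ _≤_ (⟦⟧≡mkℚ m) (⟦⟧≡mkℚ n) le)))

  c₀ : ℚ
  c₀ = + 1 / 288

  c₀-pos : 0ℚ < c₀
  c₀-pos = *<* (+<+ (ℕ.s≤s ℕ.z≤n))

  c₀-*-⟦⟧-≤ : ∀ {m n} → m ℕ.≤ 288 ℕ.* n → c₀ * ⟦ m ⟧ ≤ ⟦ n ⟧
  c₀-*-⟦⟧-≤ {m} {n} m≤288n = toℚᵘ-cancel-≤ (ℚᵘ.≤-respˡ-≃ (ℚᵘ.≃-sym (toℚᵘ-homo-* c₀ ⟦ m ⟧))
    (subst₂ (λ x y → toℚᵘ c₀ ℚᵘ.* x ℚᵘ.≤ y) (sym (toℚᵘ-⟦⟧ m)) (sym (toℚᵘ-⟦⟧ n)) (ℚᵘ.*≤* cross)))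
    where
    toℚᵘ-⟦⟧ : ∀ k → toℚᵘ ⟦ k ⟧ ≡ ℚᵘ.mkℚᵘ (+ k) 0
    toℚᵘ-⟦⟧ k = cong toℚᵘ (⟦⟧≡mkℚ k)
    cross : (+ 1 ℤ.* + m) ℤ.* + 1 ℤ.≤ + n ℤ.* + 288
    cross = subst₂ ℤ._≤_ (sym (trans (*-identityʳ _) (*-identityˡ (+ m)))) (pos-* n 288)
              (+≤+ (subst (m ℕ.≤_) (ℕ.*-comm 288 n) m≤288n))

module Disagreements where

  open import Data.Nat using (_≤_)
  open import Data.Fin using (Fin)
  open import Data.Fin.Properties using (¬∀⟶∃¬; injective⇒≤)
  open import Data.Rational.Properties using (_≟_)
  open import Data.Product using (_×_; proj₁; proj₂; ∃)
  open import Function using (_∘_)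
  open import Data.Sum using (inj₁; inj₂)
  open import Data.List using (List; length; lookup; filter; cartesianProduct; map; allFin)
  open import Data.List.Membership.Propositional using (_∈_)
  open import Data.List.Membership.Propositional.Properties
    using (∈-filter⁺; ∈-cartesianProduct⁺; ∈-map⁺; ∈-allFin; ∈-++⁺ˡ; ∈-++⁺ʳ)
  open import Data.List.Relation.Unary.Any using (index)
  open import Data.List.Relation.Unary.Any.Properties using (lookup-index)
  open import Relation.Nullary using (¬_; ¬?)
  open import Relation.Unary using (Decidable)
  open import Relation.Binary.PropositionalEquality

  Agrees : ∀ {P} → Matrix P → Matrix P → P × P → Set
  Agrees A B pq = A (proj₁ pq) (proj₂ pq) ≡ B (proj₁ pq) (proj₂ pq)

  ∈-points : ∀ {r s} (p : Pt r s) → p ∈ points r s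
  ∈-points {r} (inj₁ i) = ∈-++⁺ˡ (∈-map⁺ inj₁ (∈-allFin i))
  ∈-points {r} (inj₂ j) = ∈-++⁺ʳ (map inj₁ (allFin r)) (∈-map⁺ inj₂ (∈-allFin j))

  diffCount-≥-disjoint : ∀ {r s} {A B : Matrix (Pt r s)} {k l} (config : Fin k → Fin l → Pt r s × Pt r s) →
    (∀ {i i′ t t′} → config i t ≡ config i′ t′ → i ≡ i′) →
    (∀ i → ¬ (∀ t → Agrees A B (config i t))) →
    k ≤ diffCount r s A B
  diffCount-≥-disjoint {r} {s} {A} {B} {k} {l} config disjoint disagrees =
    injective⇒≤ {f = position} λ eq → disjoint (trans (lookup-index (chosen∈ _))
                                          (trans (cong (lookup disagreeing) eq) (sym (lookup-index (chosen∈ _)))))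
    where
    agrees? : Decidable (Agrees A B)
    agrees? pq = A (proj₁ pq) (proj₂ pq) ≟ B (proj₁ pq) (proj₂ pq)
    disagreeing : List (Pt r s × Pt r s)
    disagreeing = filter (¬? ∘ agrees?) (cartesianProduct (points r s) (points r s))
    chosen : ∀ i → ∃ λ t → ¬ Agrees A B (config i t)
    chosen i = ¬∀⟶∃¬ l (Agrees A B ∘ config i) (agrees? ∘ config i) (disagrees i)
    chosen∈ : ∀ i → config i (proj₁ (chosen i)) ∈ disagreeing
    chosen∈ i = ∈-filter⁺ (¬? ∘ agrees?) (∈-cartesianProduct⁺ (∈-points _) (∈-points _)) (proj₂ (chosen i))
    position : Fin k → Fin (length disagreeing)
    position i = index (chosen∈ i)

module Witnesses {r s : ℕ} where

  open import Data.Nat as ℕ using (suc)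
  open import Data.Nat.Properties using (<⇒≱; +-cancelˡ-≤; +-cancelˡ-≡; m≤m+n; suc-injective)
  open import Data.Rational using (ℚ; _+_; _⊔_; _≤_)
  open import Data.Rational.Properties using (+-comm; +-0-group; p≤q⇒p⊔q≡q; module ≤-Reasoning)
  open import Algebra.Properties.Group +-0-group using (∙-cancelˡ)
  open import Data.Fin using (Fin; toℕ; _<_)
  open import Data.Fin.Patterns using (0F; 1F; 2F; 3F; 4F; 5F)
  open import Data.Fin.Properties using (toℕ-injective; <⇒≢) renaming (_≟_ to _≟ᶠ_)
  open import Data.Product using (_×_; _,_)
  open import Data.Sum using (inj₁; inj₂)
  open import Data.Empty using (⊥-elim)
  open import Relation.Nullary using (¬_; yes; no)
  open import Relation.Binary.PropositionalEquality
  open FourPointCondition using (TwoEqual; TwoEqual-resp; treeMetric-fourPoint)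
  open NaturalEmbedding using (⟦⟧-injective; ⟦⟧-mono-≤; ⟦⟧-cancel-≤)
  open Disagreements using (Agrees)

  N : ℕ
  N = 2 ℕ.* (r ℕ.+ s)

  hardM-xx : ∀ {i i′ : Fin r} → i ≢ i′ → hardM r s (inj₁ i) (inj₁ i′) ≡ ⟦ N ⟧
  hardM-xx {i} {i′} i≢i′ with i ≟ᶠ i′
  ... | yes i≡i′ = ⊥-elim (i≢i′ i≡i′)
  ... | no _     = refl

  quadruplePairs : Fin r → Fin r → Fin r → Fin s → Fin 6 → Pt r s × Pt r s
  quadruplePairs a b c j 0F = inj₁ a , inj₁ b
  quadruplePairs a b c j 1F = inj₁ a , inj₁ c
  quadruplePairs a b c j 2F = inj₁ b , inj₁ c
  quadruplePairs a b c j 3F = inj₁ a , inj₂ j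
  quadruplePairs a b c j 4F = inj₁ b , inj₂ j
  quadruplePairs a b c j 5F = inj₁ c , inj₂ j

  DisagreeOnEveryQuadruple : Matrix (Pt r s) → Matrix (Pt r s) → Set
  DisagreeOnEveryQuadruple A B =
    ∀ {a b c : Fin r} {j : Fin s} → a < b → b < c → ¬ (∀ t → Agrees A B (quadruplePairs a b c j t))

  module _ {U : Matrix (Pt r s)} where

    ultrametric-disagrees : IsUltrametric U → ∀ {a b j} → a < b →
      Agrees (hardM r s) U (inj₁ a , inj₁ b) → Agrees (hardM r s) U (inj₁ a , inj₂ j) →
      ¬ Agrees (hardM r s) U (inj₁ b , inj₂ j)
    ultrametric-disagrees isUltra {a} {b} {j} a<b ab aj bj =
      <⇒≱ a<b (ℕ.s≤s⁻¹ (+-cancelˡ-≤ N _ _ (⟦⟧-cancel-≤ bound)))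
      where
      open IsUltrametric isUltra
      open IsMetric metric
      open ≤-Reasoning
      bound : ⟦ N ℕ.+ suc (toℕ b) ⟧ ≤ ⟦ N ℕ.+ suc (toℕ a) ⟧
      bound = begin
        ⟦ N ℕ.+ suc (toℕ b) ⟧                    ≡⟨ bj ⟩
        U (inj₁ b) (inj₂ j)                      ≤⟨ ultra _ _ (inj₁ a) ⟩
        U (inj₁ b) (inj₁ a) ⊔ U (inj₂ j) (inj₁ a) ≡⟨ cong₂ _⊔_ (trans (symm _ _) (sym ab)) (trans (symm _ _) (sym aj)) ⟩
        hardM r s (inj₁ a) (inj₁ b) ⊔ ⟦ N ℕ.+ suc (toℕ a) ⟧
          ≡⟨ cong (_⊔ _) (hardM-xx (<⇒≢ a<b)) ⟩
        ⟦ N ⟧ ⊔ ⟦ N ℕ.+ suc (toℕ a) ⟧            ≡⟨ p≤q⇒p⊔q≡q (⟦⟧-mono-≤ (m≤m+n N _)) ⟩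
        ⟦ N ℕ.+ suc (toℕ a) ⟧                    ∎

    treeMetric-disagrees : IsTreeMetric U → ∀ {a b c j} → a ≢ b → a ≢ c → b ≢ c →
      ¬ (∀ t → Agrees (hardM r s) U (quadruplePairs a b c j t))
    treeMetric-disagrees isTree {a} {b} {c} {j} a≢b a≢c b≢c agree =
      pairingSums-distinct (TwoEqual-resp
        (sym (cong₂ _+_ (trans (sym (hardM-xx a≢b)) (agree 0F)) (agree 5F)))
        (sym (cong₂ _+_ (trans (sym (hardM-xx a≢c)) (agree 1F)) (agree 4F)))
        (trans (+-comm (U (inj₁ a) (inj₂ j)) (U (inj₁ b) (inj₁ c)))
               (sym (cong₂ _+_ (trans (sym (hardM-xx b≢c)) (agree 2F)) (agree 3F))))
        (treeMetric-fourPoint isTree (inj₁ a) (inj₁ b) (inj₁ c) (inj₂ j)))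
      where
      pairingSum : Fin r → ℚ
      pairingSum i = ⟦ N ⟧ + ⟦ N ℕ.+ suc (toℕ i) ⟧
      pairingSum-injective : ∀ {i i′} → pairingSum i ≡ pairingSum i′ → i ≡ i′
      pairingSum-injective eq =
        toℕ-injective (suc-injective (+-cancelˡ-≡ N _ _ (⟦⟧-injective (∙-cancelˡ ⟦ N ⟧ _ _ eq))))
      pairingSums-distinct : ¬ TwoEqual (pairingSum c) (pairingSum b) (pairingSum a)
      pairingSums-distinct (inj₁ cb)        = b≢c (sym (pairingSum-injective cb))
      pairingSums-distinct (inj₂ (inj₁ ca)) = a≢c (sym (pairingSum-injective ca))
      pairingSums-distinct (inj₂ (inj₂ ba)) = a≢b (sym (pairingSum-injective ba))

module Packing {r s : ℕ} (q : ℕ) (6q≤r : 6 ℕ.* q ℕ.≤ r) where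

  open import Data.Nat using (_≤_; _<_; _∸_; _⊓_; _/_)
  open import Data.Nat.Properties
  open import Data.Nat.DivMod using (m*n/n≡m)
  open import Data.Bool using (if_then_else_)
  open import Data.Fin using (Fin; toℕ; fromℕ<; combine; remQuot)
  import Data.Fin as Fin
  open import Data.Fin.Patterns using (0F; 1F; 2F; 3F; 4F; 5F)
  open import Data.Fin.Properties using (toℕ-fromℕ<; toℕ<n; toℕ-injective; combine-remQuot)
  open import Data.Product using (_×_; _,_; proj₁; proj₂; uncurry)
  open import Data.Sum using (inj₁; inj₂)
  open import Relation.Nullary using (does)
  open import Relation.Nullary.Decidable using (dec-true; dec-false)
  open import Relation.Binary.PropositionalEquality
  open Witnesses using (quadruplePairs; DisagreeOnEveryQuadruple)
  open Disagreements using (diffCount-≥-disjoint)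

  decodeXY : ℕ → ℕ → ℕ × ℕ
  decodeXY u j =
    (if does (u <? q) then u
     else if does (u <? 3 ℕ.* q) then u ∸ q ∸ j
     else u ∸ 3 ℕ.* q ∸ 2 ℕ.* j) , j

  decodeXX : ℕ → ℕ → ℕ × ℕ
  decodeXX u v =
    if does (u <? q)
    then (u , (if does (v <? 3 ℕ.* q) then v ∸ q ∸ u else (v ∸ 3 ℕ.* q ∸ u) / 2))
    else (let j = v ∸ 3 ℕ.* q ∸ (u ∸ q) in u ∸ q ∸ j , j)

  decode : Pt r s × Pt r s → ℕ × ℕ
  decode (inj₁ u , inj₁ v) = decodeXX (toℕ u) (toℕ v)
  decode (inj₁ u , inj₂ j) = decodeXY (toℕ u) (toℕ j)
  decode _                 = 0 , 0

  module Positions {a j : ℕ} (a<q : a < q) (j<q : j < q) where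

    pos₂ pos₃ : ℕ
    pos₂ = q ℕ.+ (a ℕ.+ j)
    pos₃ = 3 ℕ.* q ℕ.+ (a ℕ.+ 2 ℕ.* j)

    a<pos₂ : a < pos₂
    a<pos₂ = <-≤-trans a<q (m≤m+n q _)

    pos₂<3q : pos₂ < 3 ℕ.* q
    pos₂<3q = +-monoʳ-< q (+-mono-< a<q (<-≤-trans j<q (≤-reflexive (sym (+-identityʳ q)))))

    pos₂<pos₃ : pos₂ < pos₃
    pos₂<pos₃ = <-≤-trans pos₂<3q (m≤m+n _ _)

    pos₃<6q : pos₃ < 6 ℕ.* q
    pos₃<6q = subst (pos₃ <_) (sym (*-distribʳ-+ q 3 3))
                (+-monoʳ-< (3 ℕ.* q) (+-mono-< a<q (*-monoʳ-< 2 j<q)))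

    decodeXY-a : decodeXY a j ≡ (a , j)
    decodeXY-a rewrite dec-true (a <? q) a<q = refl

    decodeXY-pos₂ : decodeXY pos₂ j ≡ (a , j)
    decodeXY-pos₂ rewrite dec-false (pos₂ <? q) (≤⇒≯ (m≤m+n q _)) | dec-true (pos₂ <? 3 ℕ.* q) pos₂<3q =
      cong (_, j) (trans (cong (_∸ j) (m+n∸m≡n q (a ℕ.+ j))) (m+n∸n≡m a j))

    decodeXY-pos₃ : decodeXY pos₃ j ≡ (a , j)
    decodeXY-pos₃ rewrite dec-false (pos₃ <? q) (≤⇒≯ (≤-trans (m≤m+n q _) (m≤m+n (3 ℕ.* q) _)))
                       | dec-false (pos₃ <? 3 ℕ.* q) (≤⇒≯ (m≤m+n _ _)) =
      cong (_, j) (trans (cong (_∸ 2 ℕ.* j) (m+n∸m≡n (3 ℕ.* q) _)) (m+n∸n≡m a (2 ℕ.* j)))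

    decodeXX-a-pos₂ : decodeXX a pos₂ ≡ (a , j)
    decodeXX-a-pos₂ rewrite dec-true (a <? q) a<q | dec-true (pos₂ <? 3 ℕ.* q) pos₂<3q =
      cong (a ,_) (trans (cong (_∸ a) (m+n∸m≡n q (a ℕ.+ j))) (m+n∸m≡n a j))

    decodeXX-a-pos₃ : decodeXX a pos₃ ≡ (a , j)
    decodeXX-a-pos₃ rewrite dec-true (a <? q) a<q | dec-false (pos₃ <? 3 ℕ.* q) (≤⇒≯ (m≤m+n _ _)) =
      cong (a ,_) (begin
        (pos₃ ∸ 3 ℕ.* q ∸ a) / 2   ≡⟨ cong (λ x → (x ∸ a) / 2) (m+n∸m≡n (3 ℕ.* q) _) ⟩
        (a ℕ.+ 2 ℕ.* j ∸ a) / 2    ≡⟨ cong (_/ 2) (m+n∸m≡n a (2 ℕ.* j)) ⟩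
        2 ℕ.* j / 2                ≡⟨ cong (_/ 2) (*-comm 2 j) ⟩
        j ℕ.* 2 / 2                ≡⟨ m*n/n≡m j 2 ⟩
        j                          ∎)
      where open ≡-Reasoning

    decodeXX-pos₂-pos₃ : decodeXX pos₂ pos₃ ≡ (a , j)
    decodeXX-pos₂-pos₃ rewrite dec-false (pos₂ <? q) (≤⇒≯ (m≤m+n q _))
                             | m+n∸m≡n q (a ℕ.+ j) | m+n∸m≡n (3 ℕ.* q) (a ℕ.+ 2 ℕ.* j)
                             | [m+n]∸[m+o]≡n∸o a (2 ℕ.* j) j | m+n∸m≡n j (j ℕ.+ 0) | +-identityʳ j =
      cong (_, j) (m+n∸n≡m a j)

  m : ℕ
  m = s ⊓ q

  module Configuration (a : Fin q) (j : Fin m) where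

    open Positions (toℕ<n a) (<-≤-trans (toℕ<n j) (m⊓n≤n s q)) public

    pos₃<r : pos₃ < r
    pos₃<r = <-≤-trans pos₃<6q 6q≤r

    x₁ x₂ x₃ : Fin r
    x₁ = fromℕ< (<-trans a<pos₂ (<-trans pos₂<pos₃ pos₃<r))
    x₂ = fromℕ< (<-trans pos₂<pos₃ pos₃<r)
    x₃ = fromℕ< pos₃<r

    y : Fin s
    y = fromℕ< (<-≤-trans (toℕ<n j) (m⊓n≤m s q))

    pairs : Fin 6 → Pt r s × Pt r s
    pairs = quadruplePairs x₁ x₂ x₃ y

    x₁<x₂ : x₁ Fin.< x₂
    x₁<x₂ = subst₂ _<_ (sym (toℕ-fromℕ< _)) (sym (toℕ-fromℕ< _)) a<pos₂

    x₂<x₃ : x₂ Fin.< x₃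
    x₂<x₃ = subst₂ _<_ (sym (toℕ-fromℕ< _)) (sym (toℕ-fromℕ< _)) pos₂<pos₃

    decode-pairs : ∀ t → decode (pairs t) ≡ (toℕ a , toℕ j)
    decode-pairs 0F = trans (cong₂ decodeXX (toℕ-fromℕ< _) (toℕ-fromℕ< _)) decodeXX-a-pos₂
    decode-pairs 1F = trans (cong₂ decodeXX (toℕ-fromℕ< _) (toℕ-fromℕ< _)) decodeXX-a-pos₃
    decode-pairs 2F = trans (cong₂ decodeXX (toℕ-fromℕ< _) (toℕ-fromℕ< _)) decodeXX-pos₂-pos₃
    decode-pairs 3F = trans (cong₂ decodeXY (toℕ-fromℕ< _) (toℕ-fromℕ< _)) decodeXY-a
    decode-pairs 4F = trans (cong₂ decodeXY (toℕ-fromℕ< _) (toℕ-fromℕ< _)) decodeXY-pos₂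
    decode-pairs 5F = trans (cong₂ decodeXY (toℕ-fromℕ< _) (toℕ-fromℕ< _)) decodeXY-pos₃

  diffCount-≥-packing : ∀ {A B : Matrix (Pt r s)} → DisagreeOnEveryQuadruple A B → q ℕ.* m ≤ diffCount r s A B
  diffCount-≥-packing disagrees =
    diffCount-≥-disjoint family disjoint λ k →
      disagrees (uncurry Configuration.x₁<x₂ (remQuot m k)) (uncurry Configuration.x₂<x₃ (remQuot m k))
    where
    family : Fin (q ℕ.* m) → Fin 6 → Pt r s × Pt r s
    family k = uncurry Configuration.pairs (remQuot m k)
    disjoint : ∀ {k k′ t t′} → family k t ≡ family k′ t′ → k ≡ k′
    disjoint {k} {k′} {t} {t′} eq =
      trans (sym (combine-remQuot {q} m k)) (trans (cong (uncurry combine) sameIndex) (combine-remQuot {q} m k′))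
      where
      sameLabel : (toℕ (proj₁ (remQuot {q} m k)) , toℕ (proj₂ (remQuot {q} m k))) ≡
                  (toℕ (proj₁ (remQuot {q} m k′)) , toℕ (proj₂ (remQuot {q} m k′)))
      sameLabel = trans (sym (uncurry Configuration.decode-pairs (remQuot m k) t))
                        (trans (cong decode eq) (uncurry Configuration.decode-pairs (remQuot m k′) t′))
      sameIndex : remQuot m k ≡ remQuot m k′
      sameIndex = cong₂ _,_ (toℕ-injective (cong proj₁ sameLabel)) (toℕ-injective (cong proj₂ sameLabel))

module Sizes where

  open import Data.Nat using (_≤_; _⊓_; _/_; _%_)
  open import Data.Nat.Properties
  open import Data.Nat.DivMod using (m/n*n≤m; m≡m%n+[m/n]*n; m%n<n; m≥n⇒m/n>0)
  open import Data.Nat.Solver using (module +-*-Solver)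
  open import Relation.Binary.PropositionalEquality
  open +-*-Solver

  6≤r : ∀ {r s} → 12 ≤ r ℕ.+ s → s ≤ r → 6 ≤ r
  6≤r {r} 12≤r+s s≤r = *-cancelˡ-≤ 2
    (subst (12 ≤_) (cong (r ℕ.+_) (sym (+-identityʳ r))) (≤-trans 12≤r+s (+-monoʳ-≤ r s≤r)))

  6*[r/6]≤r : ∀ r → 6 ℕ.* (r / 6) ≤ r
  6*[r/6]≤r r = subst (_≤ r) (*-comm (r / 6) 6) (m/n*n≤m r 6)

  r≤12*[r/6] : ∀ {r} → 6 ≤ r → r ≤ 12 ℕ.* (r / 6)
  r≤12*[r/6] {r} 6≤r = begin
    r                                 ≡⟨ m≡m%n+[m/n]*n r 6 ⟩
    r % 6 ℕ.+ r / 6 ℕ.* 6             ≤⟨ +-mono-≤ r%6≤6*[r/6] (≤-reflexive (*-comm (r / 6) 6)) ⟩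
    6 ℕ.* (r / 6) ℕ.+ 6 ℕ.* (r / 6)   ≡⟨ *-distribʳ-+ (r / 6) 6 6 ⟨
    12 ℕ.* (r / 6)                    ∎
    where
    open ≤-Reasoning
    r%6≤6*[r/6] : r % 6 ≤ 6 ℕ.* (r / 6)
    r%6≤6*[r/6] = ≤-trans (<⇒≤ (m%n<n r 6)) (*-monoʳ-≤ 6 (m≥n⇒m/n>0 6≤r))

  s*[r+s]≤288*[q*[s⊓q]] : ∀ {r s q} → s ≤ r → r ≤ 12 ℕ.* q → s ℕ.* (r ℕ.+ s) ≤ 288 ℕ.* (q ℕ.* (s ⊓ q))
  s*[r+s]≤288*[q*[s⊓q]] {r} {s} {q} s≤r r≤12q = begin
    s ℕ.* (r ℕ.+ s)                               ≤⟨ *-monoʳ-≤ s (+-monoʳ-≤ r s≤r) ⟩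
    s ℕ.* (r ℕ.+ r)                               ≤⟨ *-mono-≤ s≤12m (+-mono-≤ r≤12q r≤12q) ⟩
    12 ℕ.* m ℕ.* (12 ℕ.* q ℕ.+ 12 ℕ.* q)          ≡⟨ solve 2 (λ m q → con 12 :* m :* (con 12 :* q :+ con 12 :* q) := con 288 :* (q :* m)) refl m q ⟩
    288 ℕ.* (q ℕ.* m)                             ∎
    where
    open ≤-Reasoning
    m : ℕ
    m = s ⊓ q
    s≤12m : s ≤ 12 ℕ.* m
    s≤12m = subst (s ≤_) (sym (*-distribˡ-⊓ 12 s q)) (⊓-glb (m≤n*m s 12) (≤-trans s≤r r≤12q))

open import Data.Nat using (_≤_; _/_)
open import Data.Nat.Properties using (≤-trans; *-monoʳ-≤)
open import Data.Rational using (ℚ; 0ℚ; _<_; _*_) renaming (_≤_ to _≤ℚ_)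
open import Data.Product using (_×_; ∃; _,_)
open import Data.Fin.Patterns using (0F; 3F; 4F)
open import Data.Fin.Properties using (<⇒≢; <-trans)
open NaturalEmbedding using (c₀; c₀-pos; c₀-*-⟦⟧-≤)
open Witnesses using (DisagreeOnEveryQuadruple; ultrametric-disagrees; treeMetric-disagrees)
open Packing using (diffCount-≥-packing)
open Sizes using (6≤r; 6*[r/6]≤r; r≤12*[r/6]; s*[r+s]≤288*[q*[s⊓q]])

diffCount-lowerBound : ∀ {r s} {U : Matrix (Pt r s)} → 12 ≤ r ℕ.+ s → s ≤ r →
  DisagreeOnEveryQuadruple (hardM r s) U → c₀ * ⟦ s ℕ.* (r ℕ.+ s) ⟧ ≤ℚ ⟦ diffCount r s (hardM r s) U ⟧
diffCount-lowerBound {r} {s} {U} 12≤n s≤r disagree =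
  c₀-*-⟦⟧-≤ {n = diffCount r s (hardM r s) U}
    (≤-trans (s*[r+s]≤288*[q*[s⊓q]] {q = r / 6} s≤r (r≤12*[r/6] (6≤r 12≤n s≤r)))
             (*-monoʳ-≤ 288 (diffCount-≥-packing (r / 6) (6*[r/6]≤r r) disagree)))

mainTheorem4 : ∃ λ (c : ℚ) → (0ℚ < c) × ∃ λ (n₀ : ℕ) →
    ∀ (r s : ℕ) → n₀ ≤ r Data.Nat.+ s → 1 ≤ s → s ≤ r →
      (∀ (U : Matrix (Pt r s)) → IsUltrametric U →
         c * ⟦ s Data.Nat.* (r Data.Nat.+ s) ⟧ ≤ℚ ⟦ diffCount r s (hardM r s) U ⟧)
      × (∀ (U : Matrix (Pt r s)) → IsTreeMetric U →
         c * ⟦ s Data.Nat.* (r Data.Nat.+ s) ⟧ ≤ℚ ⟦ diffCount r s (hardM r s) U ⟧)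
mainTheorem4 = c₀ , c₀-pos , 12 , λ r s 12≤n _ s≤r →
    (λ U isUltra → diffCount-lowerBound 12≤n s≤r λ a<b _ agree →
       ultrametric-disagrees isUltra a<b (agree 0F) (agree 3F) (agree 4F))
  , (λ U isTree → diffCount-lowerBound 12≤n s≤r λ a<b b<c →
       treeMetric-disagrees isTree (<⇒≢ a<b) (<⇒≢ (<-trans a<b b<c)) (<⇒≢ b<c))
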